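{- Let $d,k$ be positive integers with $k\geq4$ and $d\geq 2k-3$, and let $A$ be any $k$-general $d$-position set in $P_d\,\Box\,P_2$ with $|A|=2k-3$. Then for all $i\in\{1,\ldots,d\}$: (1) if $j\in\{1,2\}$ satisfies $|A\cap(\{1,\ldots,d\}\times\{j\})|=k-1$, then $|A\cap(\{1,\ldots,i\}\times\{j\})|\leq\lceil i/2\rceil$; (2) if $j\in\{1,2\}$ satisfies $|A\cap(\{1,\ldots,d\}\times\{j\})|=k-2$, then $|A\cap(\{1,\ldots,i\}\times\{j\})|\leq\lfloor i/2\rfloor$.
   Context: $P_d\,\Box\,P_2$ is the grid with vertex set $\{1,\ldots,d\}\times\{1,2\}$, where $(i,j)$ and $(i',j')$ are adjacent iff either $j=j'$ and $|i-i'|=1$, or $i=i'$ and $j\neq j'$. For a graph $G$, a geodesic is a shortest path between two vertices; its length $\lambda(g)$ is its number of edges. For $d\ge1$, $k\ge2$, $S\subseteq V(G)$ is a $k$-general $d$-position set if every geodesic $g$ with $|S\cap V(g)|\geq k$ has $\lambda(g)>d$. -}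

module Defs where

open import Data.Nat using (ℕ; suc; _≤_; _<_; _∸_)
open import Data.Fin using (Fin; toℕ)
open import Data.Fin.Properties using () renaming (_≟_ to _≟ᶠ_)
open import Data.Product using (_×_; _,_; proj₁; proj₂)
open import Data.Product.Properties using (≡-dec)
open import Data.Sum using (_⊎_)
open import Data.List using (List; []; length; filter; head; last)
open import Data.List.Relation.Unary.Linked using (Linked)
open import Data.List.Relation.Unary.Unique.Propositional using (Unique)
open import Data.List.Relation.Unary.Any using (any?)
open import Relation.Binary.PropositionalEquality using (_≡_; _≢_)
open import Relation.Nullary using (Dec)
open import Data.Nat.Properties using (_<?_)

-- Vertices of P_d □ P_2, 0-indexed: (i , j) with i ∈ Fin d, j ∈ Fin 2.
-- Paper's vertex (i , j) corresponds to (i-1 , j-1).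
V : ℕ → Set
V d = Fin d × Fin 2

_≟V_ : ∀ {d} (u v : V d) → Dec (u ≡ v)
_≟V_ = ≡-dec _≟ᶠ_ _≟ᶠ_

Adj : ∀ {d} → V d → V d → Set
Adj (i , j) (i' , j') =
  (j ≡ j' × (toℕ i ≡ suc (toℕ i') ⊎ toℕ i' ≡ suc (toℕ i))) ⊎ (i ≡ i' × j ≢ j')

IsPath : ∀ {d} → List (V d) → Set
IsPath p = p ≢ [] × Linked Adj p × Unique p

len : ∀ {d} → List (V d) → ℕ
len p = length p ∸ 1

IsGeodesic : ∀ {d} → List (V d) → Set
IsGeodesic g = IsPath g ×
  (∀ h → IsPath h → head h ≡ head g → last h ≡ last g → len g ≤ len h)

-- |S ∩ V(g)|  (S given as a duplicate-free list)
countIn : ∀ {d} → List (V d) → List (V d) → ℕ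
countIn S g = length (filter (λ v → any? (v ≟V_) g) S)

KGenPos : (d δ k : ℕ) → List (V d) → Set
KGenPos d δ k S = ∀ (g : List (V d)) → IsGeodesic g → k ≤ countIn S g → δ < len g

rowCount : ∀ {d} → List (V d) → Fin 2 → ℕ
rowCount A j = length (filter (λ v → proj₂ v ≟ᶠ j) A)

-- |A ∩ ({1..i} × {j})|  (paper's columns 1..i are 0-indexed columns < i)
prefixCount : ∀ {d} → List (V d) → ℕ → Fin 2 → ℕ
prefixCount A i j = length (filter (λ v → proj₂ v ≟ᶠ j) (filter (λ v → toℕ (proj₁ v) <? i) A))

-- For m < d, the path that runs along row r from the first column to column m, crosses to
-- row r′ and runs on to the last column has length d, and it is a geodesic: the height
-- "column + [row = r′]" rises by at most one along any edge and by exactly one along this path.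
-- So it meets A in at most k − 1 points, i.e. P_r(m+1) + |A ∩ row r′| − P_r′(m) ≤ k − 1, where
-- P_s(i) counts the points of A in row s among the first i columns.  With row counts k − 1 and
-- k − 2 this reads P_h(m+1) ≤ P_l(m) + 1 and P_l(m+1) ≤ P_h(m), and induction on i gives the
-- bounds ⌈i/2⌉ and ⌊i/2⌋.
module Submission where

open import Defs
open import Data.Bool using (true; false; if_then_else_)
open import Data.Empty using (⊥-elim)
open import Data.Fin using (Fin; toℕ; opposite) renaming (zero to fzero; suc to fsuc)
open import Data.Fin.Properties using (toℕ-fromℕ<; toℕ-injective; toℕ≤pred[n]) renaming (_≟_ to _≟ᶠ_)
open import Data.List using (List; []; _∷_; length; filter; last; applyUpTo)
open import Data.List.Membership.Propositional using (_∈_)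
open import Data.List.Properties using (length-applyUpTo)
open import Data.List.Relation.Unary.Any.Properties using (applyUpTo⁺)
open import Data.List.Relation.Unary.Any using (any?)
open import Data.List.Relation.Unary.Linked using (Linked; [-]; _∷_)
open import Data.List.Relation.Unary.Linked.Properties as Linked using ()
open import Data.List.Relation.Unary.Unique.Propositional using (Unique)
open import Data.List.Relation.Unary.Unique.Propositional.Properties as Unique using ()
open import Data.Maybe using (just)
open import Data.Maybe.Properties using (just-injective)
open import Data.Nat using (ℕ; zero; suc; pred; _+_; _*_; _∸_; _≤_; _<_; s≤s; s≤s⁻¹; z≤n; ⌈_/2⌉; ⌊_/2⌋)
open import Data.Nat.DivMod using (_mod_; m≤n⇒m%n≡m)
open import Data.Nat.Properties
open import Algebra.Properties.CommutativeSemigroup +-commutativeSemigroup using (interchange)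
open import Data.Product using (_×_; _,_; proj₁; proj₂)
open import Data.Sum using (_⊎_; inj₁; inj₂)
open import Function using (_∘_)
open import Relation.Binary.Core using (Rel)
open import Relation.Binary.PropositionalEquality
open import Relation.Nullary using (Dec; yes; no; does; ¬_)
open import Relation.Nullary.Decidable using (dec-true; dec-false)
open import Relation.Unary using (Pred; Decidable)
open import Relation.Unary.Properties using (_∩?_)

𝟙 : ∀ {p} {P : Set p} → Dec P → ℕ
𝟙 P? = if does P? then 1 else 0

𝟙-yes : ∀ {p} {P : Set p} (P? : Dec P) → P → 𝟙 P? ≡ 1
𝟙-yes P? p = cong (if_then 1 else 0) (dec-true P? p)

𝟙≤1 : ∀ {p} {P : Set p} (P? : Dec P) → 𝟙 P? ≤ 1
𝟙≤1 (yes _) = ≤-refl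
𝟙≤1 (no _) = z≤n

𝟙-+-mono : ∀ {p q r s} {P : Set p} {Q : Set q} {R : Set r} {S : Set s}
           (P? : Dec P) (Q? : Dec Q) (R? : Dec R) (S? : Dec S) →
           (P → ¬ Q) → (P → R) → (Q → R ⊎ S) → 𝟙 P? + 𝟙 Q? ≤ 𝟙 R? + 𝟙 S?
𝟙-+-mono (yes p) (yes q) R? S? P⇒¬Q P⇒R Q⇒R⊎S = ⊥-elim (P⇒¬Q p q)
𝟙-+-mono (yes p) (no _) R? S? P⇒¬Q P⇒R Q⇒R⊎S =
  subst (_≤ 𝟙 R? + 𝟙 S?) (𝟙-yes R? (P⇒R p)) (m≤m+n (𝟙 R?) (𝟙 S?))
𝟙-+-mono (no _) (yes q) R? S? P⇒¬Q P⇒R Q⇒R⊎S with Q⇒R⊎S q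
... | inj₁ r = subst (_≤ 𝟙 R? + 𝟙 S?) (𝟙-yes R? r) (m≤m+n (𝟙 R?) (𝟙 S?))
... | inj₂ s = subst (_≤ 𝟙 R? + 𝟙 S?) (𝟙-yes S? s) (m≤n+m (𝟙 S?) (𝟙 R?))
𝟙-+-mono (no _) (no _) R? S? P⇒¬Q P⇒R Q⇒R⊎S = z≤n

module _ {a} {A : Set a} where

  count : ∀ {p} {P : Pred A p} → Decidable P → List A → ℕ
  count P? xs = length (filter P? xs)

  count-∷ : ∀ {p} {P : Pred A p} (P? : Decidable P) x xs →
            count P? (x ∷ xs) ≡ 𝟙 (P? x) + count P? xs
  count-∷ P? x xs with does (P? x)
  ... | true = refl
  ... | false = refl

  count-filter : ∀ {p q} {P : Pred A p} {Q : Pred A q} (P? : Decidable P) (Q? : Decidable Q) xs →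
                 count P? (filter Q? xs) ≡ count (Q? ∩? P?) xs
  count-filter P? Q? [] = refl
  count-filter P? Q? (x ∷ xs) with does (Q? x)
  ... | false = count-filter P? Q? xs
  ... | true with does (P? x)
  ...   | true = cong suc (count-filter P? Q? xs)
  ...   | false = count-filter P? Q? xs

  module _ {p q r s} {P : Pred A p} {Q : Pred A q} {R : Pred A r} {S : Pred A s}
           (P? : Decidable P) (Q? : Decidable Q) (R? : Decidable R) (S? : Decidable S) where

    count-+-mono : (∀ x → 𝟙 (P? x) + 𝟙 (Q? x) ≤ 𝟙 (R? x) + 𝟙 (S? x)) →
                   ∀ xs → count P? xs + count Q? xs ≤ count R? xs + count S? xs
    count-+-mono _ [] = z≤n
    count-+-mono pointwise (x ∷ xs) = begin
      count P? (x ∷ xs) + count Q? (x ∷ xs)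
        ≡⟨ cong₂ _+_ (count-∷ P? x xs) (count-∷ Q? x xs) ⟩
      (𝟙 (P? x) + count P? xs) + (𝟙 (Q? x) + count Q? xs)
        ≡⟨ interchange (𝟙 (P? x)) _ _ _ ⟩
      (𝟙 (P? x) + 𝟙 (Q? x)) + (count P? xs + count Q? xs)
        ≤⟨ +-mono-≤ (pointwise x) (count-+-mono pointwise xs) ⟩
      (𝟙 (R? x) + 𝟙 (S? x)) + (count R? xs + count S? xs)
        ≡⟨ interchange (𝟙 (R? x)) _ _ _ ⟩
      (𝟙 (R? x) + count R? xs) + (𝟙 (S? x) + count S? xs)
        ≡⟨ sym (cong₂ _+_ (count-∷ R? x xs) (count-∷ S? x xs)) ⟩
      count R? (x ∷ xs) + count S? (x ∷ xs) ∎
      where open ≤-Reasoning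

  count+count≡length : ∀ {p q} {P : Pred A p} {Q : Pred A q} (P? : Decidable P) (Q? : Decidable Q) →
                       (∀ x → 𝟙 (P? x) + 𝟙 (Q? x) ≡ 1) →
                       ∀ xs → count P? xs + count Q? xs ≡ length xs
  count+count≡length P? Q? _ [] = refl
  count+count≡length P? Q? exactlyOne (x ∷ xs) = begin
    count P? (x ∷ xs) + count Q? (x ∷ xs)
      ≡⟨ cong₂ _+_ (count-∷ P? x xs) (count-∷ Q? x xs) ⟩
    (𝟙 (P? x) + count P? xs) + (𝟙 (Q? x) + count Q? xs)
      ≡⟨ interchange (𝟙 (P? x)) _ _ _ ⟩
    (𝟙 (P? x) + 𝟙 (Q? x)) + (count P? xs + count Q? xs)
      ≡⟨ cong₂ _+_ (exactlyOne x) (count+count≡length P? Q? exactlyOne xs) ⟩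
    suc (length xs) ∎
    where open ≡-Reasoning

last-applyUpTo : ∀ {a} {A : Set a} (f : ℕ → A) k → last (applyUpTo f (suc k)) ≡ just (f k)
last-applyUpTo f zero = refl
last-applyUpTo f (suc k) = last-applyUpTo (f ∘ suc) k

module _ {a ℓ} {A : Set a} {R : Rel A ℓ}
         (f : A → ℕ) (f-step : ∀ {x y} → R x y → f y ≤ suc (f x)) where

  linked-last-≤ : ∀ {x y} xs → Linked R (x ∷ xs) → last (x ∷ xs) ≡ just y →
                  f y ≤ f x + length xs
  linked-last-≤ [] [-] refl = ≤-reflexive (sym (+-identityʳ _))
  linked-last-≤ {x} {y} (z ∷ xs) (Rxz ∷ linked) last≡y = begin
    f y                  ≤⟨ linked-last-≤ xs linked last≡y ⟩
    f z + length xs      ≤⟨ +-monoˡ-≤ (length xs) (f-step Rxz) ⟩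
    suc (f x) + length xs ≡⟨ sym (+-suc (f x) (length xs)) ⟩
    f x + suc (length xs) ∎
    where open ≤-Reasoning

height : ∀ {d} → Fin 2 → V d → ℕ
height r (c , s) = toℕ c + 𝟙 (s ≟ᶠ r)

height-adj : ∀ {d} r {u v : V d} → Adj u v → height r v ≤ suc (height r u)
height-adj r {c , s} {c′ , .s} (inj₁ (refl , inj₁ c≡1+c′)) rewrite c≡1+c′ =
  ≤-trans (n≤1+n _) (n≤1+n _)
height-adj r {c , s} {c′ , .s} (inj₁ (refl , inj₂ c′≡1+c)) rewrite c′≡1+c = ≤-refl
height-adj r {c , s} {.c , s′} (inj₂ (refl , _)) = begin
  toℕ c + 𝟙 (s′ ≟ᶠ r) ≤⟨ +-monoʳ-≤ (toℕ c) (𝟙≤1 (s′ ≟ᶠ r)) ⟩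
  toℕ c + 1           ≡⟨ +-comm (toℕ c) 1 ⟩
  suc (toℕ c)         ≤⟨ s≤s (m≤m+n (toℕ c) _) ⟩
  suc (toℕ c + 𝟙 (s ≟ᶠ r)) ∎
  where open ≤-Reasoning

-- Every edge raises the height by at most one, so no path between the same endpoints is shorter.
height-tight⇒geodesic : ∀ {d} r {x y : V d} {xs} → IsPath (x ∷ xs) → last (x ∷ xs) ≡ just y →
                        height r y ≡ height r x + length xs → IsGeodesic (x ∷ xs)
height-tight⇒geodesic r path _ _ .proj₁ = path
height-tight⇒geodesic r {x} {y} {xs} _ last≡y tight .proj₂ [] (nonempty , _) _ _ =
  ⊥-elim (nonempty refl)
height-tight⇒geodesic r {x} {y} {xs} _ last≡y tight .proj₂ (z ∷ zs) (_ , linked , _) head≡ last≡ =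
  +-cancelˡ-≤ (height r x) _ _ (begin
    height r x + length xs ≡⟨ sym tight ⟩
    height r y             ≤⟨ linked-last-≤ (height r) (height-adj r) zs linked (trans last≡ last≡y) ⟩
    height r z + length zs ≡⟨ cong (λ w → height r w + length zs) (just-injective head≡) ⟩
    height r x + length zs ∎)
  where open ≤-Reasoning

geodesic-count : ∀ {d k} {A g : List (V d)} → KGenPos d d (suc k) A →
                 IsGeodesic g → len g ≡ d → countIn A g ≤ k
geodesic-count kgen geodesic len≡d =
  ≮⇒≥ (λ k<count → <-irrefl (sym len≡d) (kgen _ geodesic k<count))

module Grid (n : ℕ) where

  column : ℕ → Fin (suc n)
  column a = a mod suc n

  toℕ-column : ∀ {a} → a ≤ n → toℕ (column a) ≡ a
  toℕ-column a≤n = trans (toℕ-fromℕ< _) (m≤n⇒m%n≡m a≤n)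

  column-toℕ : ∀ c → column (toℕ c) ≡ c
  column-toℕ c = toℕ-injective (toℕ-column (toℕ≤pred[n] c))

  column-adj : ∀ {a} s → suc a ≤ n → Adj (column a , s) (column (suc a) , s)
  column-adj {a} s 1+a≤n =
    inj₁ (refl , inj₂ (trans (toℕ-column 1+a≤n) (cong suc (sym (toℕ-column (≤-trans (n≤1+n a) 1+a≤n))))))

  corner : ℕ → Fin 2 → Fin 2 → ℕ → V (suc n)
  corner m r r′ t with t ≤? m
  ... | yes _ = column t , r
  ... | no _ = column (pred t) , r′

  module Corner {m : ℕ} {r r′ : Fin 2} (m≤n : m ≤ n) (r≢r′ : r ≢ r′) where

    corner-≤ : ∀ {t} → t ≤ m → corner m r r′ t ≡ (column t , r)
    corner-≤ {t} t≤m with t ≤? m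
    ... | yes _ = refl
    ... | no t≰m = ⊥-elim (t≰m t≤m)

    corner-> : ∀ {t} → m < t → corner m r r′ t ≡ (column (pred t) , r′)
    corner-> {t} m<t with t ≤? m
    ... | yes t≤m = ⊥-elim (<⇒≱ m<t t≤m)
    ... | no _ = refl

    height-corner : ∀ t → t ≤ suc n → height r′ (corner m r r′ t) ≡ t
    height-corner t t≤1+n with ≤-<-connex t m
    ... | inj₁ t≤m rewrite corner-≤ t≤m | dec-false (r ≟ᶠ r′) r≢r′ =
      trans (+-identityʳ _) (toℕ-column (≤-trans t≤m m≤n))
    height-corner (suc t) 1+t≤1+n | inj₂ m<1+t rewrite corner-> m<1+t | dec-true (r′ ≟ᶠ r′) refl =
      trans (cong (_+ 1) (toℕ-column (s≤s⁻¹ 1+t≤1+n))) (+-comm t 1)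

    corner-injective : ∀ {i j} → i ≤ suc n → j ≤ suc n → corner m r r′ i ≡ corner m r r′ j → i ≡ j
    corner-injective {i} {j} i≤ j≤ eq =
      trans (sym (height-corner i i≤)) (trans (cong (height r′) eq) (height-corner j j≤))

    corner-adj : ∀ t → t ≤ n → Adj (corner m r r′ t) (corner m r r′ (suc t))
    corner-adj t t≤n with ≤-<-connex (suc t) m | ≤-<-connex t m
    ... | inj₁ 1+t≤m | _ rewrite corner-≤ 1+t≤m | corner-≤ (≤-trans (n≤1+n t) 1+t≤m) =
      column-adj r (≤-trans 1+t≤m m≤n)
    ... | inj₂ m<1+t | inj₁ t≤m rewrite corner-> m<1+t | corner-≤ t≤m = inj₂ (refl , r≢r′)
    corner-adj (suc t) 1+t≤n | inj₂ m<2+t | inj₂ (s≤s m≤t)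
      rewrite corner-> m<2+t | corner-> (s≤s m≤t) = column-adj r′ 1+t≤n

    cornerPath : List (V (suc n))
    cornerPath = applyUpTo (corner m r r′) (suc (suc n))

    cornerPath-isPath : IsPath cornerPath
    cornerPath-isPath =
      (λ ()) ,
      Linked.applyUpTo⁺₁ (corner m r r′) (suc (suc n)) (λ 2+i≤2+n → corner-adj _ (s≤s⁻¹ (s≤s⁻¹ 2+i≤2+n))) ,
      Unique.applyUpTo⁺₁ (corner m r r′) (suc (suc n))
        (λ i<j j<2+n → <⇒≢ i<j ∘ corner-injective (≤-trans (<⇒≤ i<j) (s≤s⁻¹ j<2+n)) (s≤s⁻¹ j<2+n))

    cornerPath-isGeodesic : IsGeodesic cornerPath
    cornerPath-isGeodesic =
      height-tight⇒geodesic r′ cornerPath-isPath (last-applyUpTo (corner m r r′) (suc n))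
        (trans (height-corner (suc n) ≤-refl)
          (cong₂ _+_ (sym (height-corner 0 z≤n)) (sym (length-applyUpTo (corner m r r′ ∘ suc) (suc n)))))

    len-cornerPath : len cornerPath ≡ suc n
    len-cornerPath = cong (_∸ 1) (length-applyUpTo (corner m r r′) (suc (suc n)))

    ∈-cornerPath-before : ∀ c → toℕ c ≤ m → (c , r) ∈ cornerPath
    ∈-cornerPath-before c c≤m =
      applyUpTo⁺ (corner m r r′)
        (trans (cong (_, r) (sym (column-toℕ c))) (sym (corner-≤ c≤m)))
        (s≤s (≤-trans (toℕ≤pred[n] c) (n≤1+n n)))

    ∈-cornerPath-after : ∀ c → m ≤ toℕ c → (c , r′) ∈ cornerPath
    ∈-cornerPath-after c m≤c =
      applyUpTo⁺ (corner m r r′)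
        (trans (cong (_, r′) (sym (column-toℕ c))) (sym (corner-> (s≤s m≤c))))
        (s≤s (s≤s (toℕ≤pred[n] c)))

    corner-count : ∀ {k} (A : List (V (suc n))) → KGenPos (suc n) (suc n) (suc k) A →
                   prefixCount A (suc m) r + rowCount A r′ ≤ k + prefixCount A m r′
    corner-count {k} A kgen = begin
      prefixCount A (suc m) r + rowCount A r′
        ≡⟨ cong (_+ rowCount A r′) (count-filter (inRow r) (columnBelow (suc m)) A) ⟩
      count (columnBelow (suc m) ∩? inRow r) A + count (inRow r′) A
        ≤⟨ count-+-mono (columnBelow (suc m) ∩? inRow r) (inRow r′) onPath (columnBelow m ∩? inRow r′)
             covered A ⟩
      countIn A cornerPath + count (columnBelow m ∩? inRow r′) A
        ≡⟨ cong (countIn A cornerPath +_) (sym (count-filter (inRow r′) (columnBelow m) A)) ⟩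
      countIn A cornerPath + prefixCount A m r′
        ≤⟨ +-monoˡ-≤ (prefixCount A m r′) (geodesic-count {A = A} kgen cornerPath-isGeodesic len-cornerPath) ⟩
      k + prefixCount A m r′ ∎
      where
      open ≤-Reasoning
      inRow : ∀ s → Decidable {A = V (suc n)} (λ v → proj₂ v ≡ s)
      inRow s v = proj₂ v ≟ᶠ s
      columnBelow : ∀ i → Decidable {A = V (suc n)} (λ v → toℕ (proj₁ v) < i)
      columnBelow i v = toℕ (proj₁ v) <? i
      onPath : Decidable (_∈ cornerPath)
      onPath v = any? (v ≟V_) cornerPath
      on-row-r′ : ∀ c s → s ≡ r′ → (c , s) ∈ cornerPath ⊎ (toℕ c < m × s ≡ r′)
      on-row-r′ c s refl with <-≤-connex (toℕ c) m
      ... | inj₁ c<m = inj₂ (c<m , refl)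
      ... | inj₂ m≤c = inj₁ (∈-cornerPath-after c m≤c)
      covered : ∀ v → 𝟙 ((columnBelow (suc m) ∩? inRow r) v) + 𝟙 (inRow r′ v)
                    ≤ 𝟙 (onPath v) + 𝟙 ((columnBelow m ∩? inRow r′) v)
      covered v@(c , s) = 𝟙-+-mono ((columnBelow (suc m) ∩? inRow r) v) (inRow r′ v)
                                   (onPath v) ((columnBelow m ∩? inRow r′) v)
        (λ (_ , s≡r) s≡r′ → r≢r′ (trans (sym s≡r) s≡r′))
        (λ { (c≤m , refl) → ∈-cornerPath-before c (s≤s⁻¹ c≤m) })
        (on-row-r′ c s)

  prefixCount-zero : (A : List (V (suc n))) (r : Fin 2) → prefixCount A 0 r ≡ 0
  prefixCount-zero [] r = refl
  prefixCount-zero (_ ∷ A) r = prefixCount-zero A r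

  module TwoRows {k} {A : List (V (suc n))} (kgen : KGenPos (suc n) (suc n) (suc (suc k)) A)
                 {h l : Fin 2} (h≢l : h ≢ l)
                 (rowCount-h : rowCount A h ≡ suc k) (rowCount-l : rowCount A l ≡ k) where

    prefix-step-h : ∀ {m} → m ≤ n → prefixCount A (suc m) h ≤ suc (prefixCount A m l)
    prefix-step-h {m} m≤n = +-cancelʳ-≤ k _ _ (begin
      prefixCount A (suc m) h + k           ≡⟨ cong (prefixCount A (suc m) h +_) (sym rowCount-l) ⟩
      prefixCount A (suc m) h + rowCount A l ≤⟨ Corner.corner-count m≤n h≢l A kgen ⟩
      suc k + prefixCount A m l              ≡⟨ cong suc (+-comm k _) ⟩
      suc (prefixCount A m l) + k ∎)
      where open ≤-Reasoning

    prefix-step-l : ∀ {m} → m ≤ n → prefixCount A (suc m) l ≤ prefixCount A m h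
    prefix-step-l {m} m≤n = +-cancelʳ-≤ (suc k) _ _ (begin
      prefixCount A (suc m) l + suc k        ≡⟨ cong (prefixCount A (suc m) l +_) (sym rowCount-h) ⟩
      prefixCount A (suc m) l + rowCount A h ≤⟨ Corner.corner-count m≤n (h≢l ∘ sym) A kgen ⟩
      suc k + prefixCount A m h              ≡⟨ +-comm (suc k) _ ⟩
      prefixCount A m h + suc k ∎)
      where open ≤-Reasoning

    prefix-bounds : ∀ i → i ≤ suc n → prefixCount A i h ≤ ⌈ i /2⌉ × prefixCount A i l ≤ ⌊ i /2⌋
    prefix-bounds zero _ = ≤-reflexive (prefixCount-zero A h) , ≤-reflexive (prefixCount-zero A l)
    prefix-bounds (suc m) 1+m≤1+n =
      let bound-h , bound-l = prefix-bounds m (≤-trans (n≤1+n m) 1+m≤1+n)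
      in ≤-trans (prefix-step-h (s≤s⁻¹ 1+m≤1+n)) (s≤s bound-l) ,
         ≤-trans (prefix-step-l (s≤s⁻¹ 1+m≤1+n)) bound-h

≢-opposite : (j : Fin 2) → j ≢ opposite j
≢-opposite fzero ()
≢-opposite (fsuc fzero) ()

rowCount+rowCount-opposite : ∀ {d} (A : List (V d)) j → rowCount A j + rowCount A (opposite j) ≡ length A
rowCount+rowCount-opposite A j = count+count≡length _ _ (λ v → exactlyOne j (proj₂ v)) A
  where
  exactlyOne : ∀ j s → 𝟙 (s ≟ᶠ j) + 𝟙 (s ≟ᶠ opposite j) ≡ 1
  exactlyOne fzero fzero = refl
  exactlyOne fzero (fsuc fzero) = refl
  exactlyOne (fsuc fzero) fzero = refl
  exactlyOne (fsuc fzero) (fsuc fzero) = refl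

2*[2+k]∸3≡[1+k]+k : ∀ k → 2 * suc (suc k) ∸ 3 ≡ suc k + k
2*[2+k]∸3≡[1+k]+k k rewrite +-identityʳ k | +-suc k (suc k) | +-suc k k = refl

lemma6p5 : (d k : ℕ) → 4 ≤ k → 2 * k ∸ 3 ≤ d →
    (A : List (V d)) → Unique A → KGenPos d d k A → length A ≡ 2 * k ∸ 3 →
    (i : ℕ) → 1 ≤ i → i ≤ d → (j : Fin 2) →
      (rowCount A j ≡ k ∸ 1 → prefixCount A i j ≤ ⌈ i /2⌉) ×
      (rowCount A j ≡ k ∸ 2 → prefixCount A i j ≤ ⌊ i /2⌋)
lemma6p5 zero (suc (suc (suc (suc _)))) (s≤s (s≤s (s≤s (s≤s _)))) () A _ _ _ i _ _ j
lemma6p5 (suc n) (suc (suc k@(suc (suc _)))) (s≤s (s≤s (s≤s (s≤s _)))) _ A _ kgen |A| i _ i≤d j =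
  (λ j-full → proj₁ (TwoRows.prefix-bounds {A = A} kgen (≢-opposite j) j-full (opposite-short j-full) i i≤d)) ,
  (λ j-short → proj₂ (TwoRows.prefix-bounds {A = A} kgen (≢-opposite j ∘ sym) (opposite-full j-short) j-short i i≤d))
  where
  open Grid n
  rows : rowCount A j + rowCount A (opposite j) ≡ suc k + k
  rows = trans (rowCount+rowCount-opposite A j) (trans |A| (2*[2+k]∸3≡[1+k]+k k))
  opposite-short : rowCount A j ≡ suc k → rowCount A (opposite j) ≡ k
  opposite-short j-full = +-cancelˡ-≡ (suc k) _ _ (trans (cong (_+ rowCount A (opposite j)) (sym j-full)) rows)
  opposite-full : rowCount A j ≡ k → rowCount A (opposite j) ≡ suc k
  opposite-full j-short = +-cancelˡ-≡ k _ _
    (trans (cong (_+ rowCount A (opposite j)) (sym j-short)) (trans rows (+-comm (suc k) k)))
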